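{- Let $N=n_1+\cdots+n_k$, $\{0,1\}^N=\{0,1\}^{n_1}\times\cdots\times\{0,1\}^{n_k}$. For any nonempty outer intact PDC $k$-wise symmetric set $S\subseteq\{0,1\}^N$, with projections $S_1,\dots,S_k$, we have \[ r_N(S)=\sum_{j=1}^kr_{n_j}(S_j)=\sum_{j=1}^k\mathrm{out}_{n_j}(S_j). \]
   Context: Index complexity: for $T\subseteq\{0,1\}^p$, $r_p(T)=\min\{|I|:I\subseteq[p],\ \exists a\in T\text{ with } b_I\neq a_I\text{ for all } b\in T,\ b\ne a\}$, where $x_I=(x_i)_{i\in I}$. A set $R\subseteq\{0,1\}^p$ is symmetric if closed under coordinate permutations; $W_p(R)=\{|x|:x\in R\}$ ($|x|$ Hamming weight). For $a\in[-1,p-1]$, $b\in[1,p+1]$, $a<b$, $I_{p,a,b}=[0,a]\cup[b,p]$ (with $[0,-1]=[p+1,p]=\emptyset$) and the peripheral interval $J_{p,a,b}$ is the symmetric set with weight set $I_{p,a,b}$. For symmetric $R$, among peripheral intervals $J_{p,a,b}\supseteq R$ with $|I_{p,a,b}|$ minimum, the minimizer of $|a+b-p|$ is either a unique $J_{p,a,b}$, and then the outer interval is $\mathrm{outint}(R)=J_{p,a,b}$, or a pair $J_{p,a,b},J_{p,p-b,p-a}$, and then $\mathrm{outint}(R)=J_{p,a,b}$ for the one with $a>p-b$; $\mathrm{out}_p(R)=a+p-b+1$ where $J_{p,a,b}=\mathrm{outint}(R)$. A set $S\subseteq\{0,1\}^N$ is $k$-wise symmetric if invariant under permuting coordinates within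 each block; $W_{(n_1,\dots,n_k)}(S)=\{(|x_1|,\dots,|x_k|):(x_1,\dots,x_k)\in S\}$; $S_j$ is the projection of $S$ to block $j$. $S$ is PDC if for some total orders $\le_j$ on $W_{n_j}(S_j)$, each either the usual or reverse order, $W_{(n_1,\dots,n_k)}(S)$ is downward closed in $W_{n_1}(S_1)\times\cdots\times W_{n_k}(S_k)$ under the induced componentwise order. With $W_{n_j}(S_j)=\{w_{j,0}<_j\cdots<_jw_{j,q_j}\}$, $[S]_{j,z}$ is the symmetric set with weights $\{w_{j,0},\dots,w_{j,z}\}$; $\mathcal N(S)=\{(z_1,\dots,z_k): z_j\le q_j,\ (w_{1,z_1},\dots,w_{k,z_k})\in W_{(n_1,\dots,n_k)}(S)\}$, and $\mathrm{innext}(S)$ is the set of maximal elements of $\mathcal N(S)$ in the componentwise order. $S$ is outer intact if for every $(z_1,\dots,z_k)\in\mathrm{innext}(S)$ and $j\in[k]$, $\mathrm{outint}([S]_{j,z_j})=\mathrm{outint}(S_j)$. -}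

module Defs where

open import Data.Bool using (Bool; true; false; _∧_; _∨_; not; if_then_else_)
open import Data.Nat using (ℕ; zero; suc; _+_; _∸_; _≤_; _<_; _⊓_; _≡ᵇ_; _≤ᵇ_; _<ᵇ_)
open import Data.Product using (_×_; _,_; Σ; ∃; proj₁; proj₂)
open import Data.Maybe using (Maybe; just; nothing; fromMaybe)
open import Data.Fin using (Fin; zero; suc; toℕ)
import Data.Fin as F
open import Data.Fin.Permutation using (Permutation′; _⟨$⟩ʳ_)
open import Data.List as L using (List; []; _∷_; _++_; upTo; filterᵇ; concatMap)
open import Data.Bool.ListAction using (any; all)
open import Data.Vec as V using (Vec; []; _∷_)
open import Relation.Binary.PropositionalEquality using (_≡_)

BSet : ℕ → Set
BSet p = Vec Bool p → Bool

allVecs : (p : ℕ) → List (Vec Bool p)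
allVecs zero    = [] ∷ []
allVecs (suc p) = L.map (true ∷_) (allVecs p) ++ L.map (false ∷_) (allVecs p)

wt : ∀ {p} → Vec Bool p → ℕ
wt []           = 0
wt (true  ∷ xs) = suc (wt xs)
wt (false ∷ xs) = wt xs

eqBits : List Bool → List Bool → Bool
eqBits []       []       = true
eqBits (x ∷ xs) (y ∷ ys) = ((x ∧ y) ∨ (not x ∧ not y)) ∧ eqBits xs ys
eqBits _        _        = false

eqVec : ∀ {p} → Vec Bool p → Vec Bool p → Bool
eqVec u v = eqBits (V.toList u) (V.toList v)

-- x_I : the restriction of x to the index set I ⊆ [p]
-- (I given as its indicator vector).
restrict : ∀ {p} → Vec Bool p → Vec Bool p → List Bool
restrict []           []       = []
restrict (true  ∷ I)  (x ∷ xs) = x ∷ restrict I xs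
restrict (false ∷ I)  (x ∷ xs) = restrict I xs

separates : ∀ {p} → BSet p → Vec Bool p → Vec Bool p → Bool
separates {p} T I a =
  T a ∧ all (λ b → not (T b) ∨ eqVec b a ∨ not (eqBits (restrict I b) (restrict I a)))
            (allVecs p)

-- Index complexity r_p(T) = min { |I| : I ⊆ [p], ∃ a ∈ T, b_I ≠ a_I ∀ b ∈ T, b ≠ a }.
-- (The minimum is over a finite set; the default value p is only used
-- when the set is empty, i.e. T = ∅, which never occurs below.)
minList : ℕ → List ℕ → ℕ
minList d []       = d
minList d (x ∷ xs) = x ⊓ minList d xs

indexComplexity : (p : ℕ) → BSet p → ℕ
indexComplexity p T =
  minList p (L.map wt (filterᵇ (λ I → any (separates T I) (allVecs p)) (allVecs p)))

permute : ∀ {p} → Permutation′ p → Vec Bool p → Vec Bool p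
permute σ x = V.tabulate (λ i → V.lookup x (σ ⟨$⟩ʳ i))

weights : (p : ℕ) → BSet p → List ℕ
weights p R = filterᵇ (λ w → any (λ x → R x ∧ (wt x ≡ᵇ w)) (allVecs p)) (upTo (suc p))

-- Peripheral intervals are encoded by pairs (s , c) with
--   s = a + 1  (number of lower weights 0..a),
--   c = p + 1 - b  (number of upper weights b..p).
-- The constraints a ∈ [-1,p-1], b ∈ [1,p+1], a < b become
--   s ≤ p, c ≤ p, s + c ≤ p + 1.
-- Then  I_{p,a,b} = { w : w < s or p < w + c },  |I_{p,a,b}| = s + c,
-- |a + b - p| = |s - c|, and J_{p,p-b,p-a} is encoded by (c , s),
-- and the condition a > p - b reads c < s.
validPI : ℕ → ℕ × ℕ → Bool
validPI p (s , c) = (s ≤ᵇ p) ∧ (c ≤ᵇ p) ∧ ((s + c) ≤ᵇ suc p)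

inPI : ℕ → ℕ × ℕ → ℕ → Bool
inPI p (s , c) w = (w <ᵇ s) ∨ (p <ᵇ (w + c))

-- J_{p,a,b} ⊇ R  iff  W_p(R) ⊆ I_{p,a,b}.
containsPI : (p : ℕ) → BSet p → ℕ × ℕ → Bool
containsPI p R sc = all (inPI p sc) (weights p R)

allPI : ℕ → List (ℕ × ℕ)
allPI p = filterᵇ (validPI p) (concatMap (λ s → L.map (s ,_) (upTo (suc p))) (upTo (suc p)))

dist : ℕ → ℕ → ℕ
dist m n = (m ∸ n) + (n ∸ m)

-- 'better x y' : x is strictly preferred to y according to the definition of
-- outint: smaller |I|, then smaller |a+b-p|, then (for the mirror pair) a > p-b.
better : ℕ × ℕ → ℕ × ℕ → Bool
better (s , c) (s' , c') =
  ((s + c) <ᵇ (s' + c'))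
  ∨ (((s + c) ≡ᵇ (s' + c'))
     ∧ ((dist s c <ᵇ dist s' c')
        ∨ ((dist s c ≡ᵇ dist s' c') ∧ (c <ᵇ s))))

bestOf : List (ℕ × ℕ) → Maybe (ℕ × ℕ)
bestOf []       = nothing
bestOf (x ∷ xs) with bestOf xs
... | nothing = just x
... | just y  = if better x y then just x else just y

outint : (p : ℕ) → BSet p → ℕ × ℕ
outint p R = fromMaybe (0 , 0) (bestOf (filterᵇ (containsPI p R) (allPI p)))

-- out_p(R) = a + p - b + 1 = s + c - 1.
out : (p : ℕ) → BSet p → ℕ
out p R = let (s , c) = outint p R in s + c ∸ 1

total : ∀ {k} → Vec ℕ k → ℕ
total = V.sum

block : ∀ {k} (ns : Vec ℕ k) → Vec Bool (total ns) → (j : Fin k) → Vec Bool (V.lookup ns j)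
block (n ∷ ns) x zero    = V.take n x
block (n ∷ ns) x (suc j) = block ns (V.drop n x) j

KWiseSymmetric : ∀ {k} (ns : Vec ℕ k) → BSet (total ns) → Set
KWiseSymmetric {k} ns S =
  (σ : (j : Fin k) → Permutation′ (V.lookup ns j)) (x y : Vec Bool (total ns)) →
  (∀ j → block ns y j ≡ permute (σ j) (block ns x j)) →
  S x ≡ true → S y ≡ true

proj : ∀ {k} (ns : Vec ℕ k) → BSet (total ns) → (j : Fin k) → BSet (V.lookup ns j)
proj ns S j y = any (λ x → S x ∧ eqVec (block ns x j) y) (allVecs (total ns))

InW : ∀ {k} (ns : Vec ℕ k) → BSet (total ns) → (Fin k → ℕ) → Set
InW ns S v = ∃ λ x → (S x ≡ true) × (∀ j → wt (block ns x j) ≡ v j)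

InWj : ∀ {k} (ns : Vec ℕ k) → BSet (total ns) → Fin k → ℕ → Set
InWj ns S j u = ∃ λ y → (proj ns S j y ≡ true) × (wt y ≡ u)

leqDir : Bool → ℕ → ℕ → Set
leqDir false u v = u ≤ v
leqDir true  u v = v ≤ u

DownClosed : ∀ {k} (ns : Vec ℕ k) → BSet (total ns) → (Fin k → Bool) → Set
DownClosed ns S d =
  ∀ (v w : Fin _ → ℕ) → InW ns S w → (∀ j → InWj ns S j (v j)) →
  (∀ j → leqDir (d j) (v j) (w j)) → InW ns S v

PDC : ∀ {k} (ns : Vec ℕ k) → BSet (total ns) → Set
PDC {k} ns S = Σ (Fin k → Bool) (DownClosed ns S)

orderedW : ∀ {k} (ns : Vec ℕ k) → BSet (total ns) → (Fin k → Bool) → (j : Fin k) → List ℕ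
orderedW ns S d j =
  if d j then L.reverse (weights _ (proj ns S j)) else weights _ (proj ns S j)

truncSym : ∀ {k} (ns : Vec ℕ k) (S : BSet (total ns)) (d : Fin k → Bool) (j : Fin k) →
           Fin (L.length (orderedW ns S d j)) → BSet (V.lookup ns j)
truncSym ns S d j z y = any (λ w → wt y ≡ᵇ w) (L.take (suc (toℕ z)) (orderedW ns S d j))

Idx : ∀ {k} (ns : Vec ℕ k) → BSet (total ns) → (Fin k → Bool) → Set
Idx {k} ns S d = (j : Fin k) → Fin (L.length (orderedW ns S d j))

InN : ∀ {k} (ns : Vec ℕ k) (S : BSet (total ns)) (d : Fin k → Bool) → Idx ns S d → Set
InN ns S d z = InW ns S (λ j → L.lookup (orderedW ns S d j) (z j))

InInnext : ∀ {k} (ns : Vec ℕ k) (S : BSet (total ns)) (d : Fin k → Bool) → Idx ns S d → Set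
InInnext ns S d z =
  InN ns S d z ×
  (∀ z' → InN ns S d z' → (∀ j → z j F.≤ z' j) → ∀ j → z' j ≡ z j)

OuterIntact : ∀ {k} (ns : Vec ℕ k) → BSet (total ns) → (Fin k → Bool) → Set
OuterIntact ns S d =
  ∀ z → InInnext ns S d z → ∀ j →
  outint (V.lookup ns j) (truncSym ns S d j (z j)) ≡ outint (V.lookup ns j) (proj ns S j)

sumFin : ∀ {k} → (Fin k → ℕ) → ℕ
sumFin f = V.sum (V.tabulate f)

-- For a symmetric set R ⊆ {0,1}^p, the words agreeing with a on I realise
-- exactly the weights of the window [u , p - v], where u and v count the ones
-- and zeros of a on I. So I separates a in R iff wt a is the only weight of R in
-- that window and is one of its endpoints; a window of size p - |I| of this kind
-- exists exactly when R fits in a peripheral interval of size |I| + 1, which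
-- gives r_p(R) = out_p(R).
--
-- For the k-wise symmetric S, separation is done blockwise at an element z of
-- innext(S). Outer intactness says that the truncations [S]_{j,z_j} have the
-- same outer intervals as the S_j. Upper bound: the windows of the truncations
-- have endpoints below w_{j,z_j}, so by downward closure one word of S realises
-- all of them, and the blockwise separators add up to Σ out(S_j). Lower bound:
-- replacing one block of a separated word by any word whose weight is below
-- w_{j,z_j} stays inside S, by downward closure and k-wise symmetry, so a
-- separator of S restricts to separators of the truncations.

module Submission where

open import Defs
open import Data.Bool as Bool using (Bool; true; false; _∧_; _∨_; not; T)
open import Data.Bool.ListAction using (any; all)
open import Data.Bool.Properties using (T-≡)
open import Data.Empty using (⊥; ⊥-elim)
open import Data.Fin as Fin using (Fin; zero; suc; toℕ)
open import Data.Fin.Permutation as Perm using (Permutation′; _⟨$⟩ʳ_; _⟨$⟩ˡ_; lift₀; transpose; _∘ₚ_; inverseʳ)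
open import Data.Fin.Properties using (toℕ-injective; all?)
open import Data.List as L using (List; []; _∷_; upTo; filterᵇ; concatMap)
open import Data.List.Extrema.Nat using (argmax; argmax-all; f[xs]≤f[argmax])
open import Data.List.Membership.Propositional using (_∈_; find; lose)
open import Data.List.Membership.Propositional.Properties
  using (∈-map⁺; ∈-map⁻; ∈-++⁺ˡ; ∈-++⁺ʳ; ∈-filter⁺; ∈-filter⁻; ∈-upTo⁺; ∈-concatMap⁺; ∈-lookup)
open import Data.List.Properties using (∷-injectiveˡ; ∷-injectiveʳ)
import Data.List.Relation.Unary.All as All
open import Data.List.Relation.Unary.All.Properties using (all⁺; all⁻; all-filter)
open import Data.List.Relation.Unary.AllPairs using (AllPairs; []; _∷_)
import Data.List.Relation.Unary.AllPairs.Properties as AllPairs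
open import Data.List.Relation.Unary.Any as Any using (here; there)
open import Data.List.Relation.Unary.Any.Properties using (any⁺; any⁻; reverse⁺; reverse⁻; lookup-index)
open import Data.Maybe using (just; nothing)
open import Data.Nat using (ℕ; zero; suc; _+_; _∸_; _≤_; _<_; _≡ᵇ_; _≤ᵇ_; _<ᵇ_; z≤n; s≤s)
open import Data.Nat.Properties
open import Data.List.Membership.DecPropositional Data.Nat._≟_ using (_∈?_)
open import Data.Product as Product using (Σ; ∃; _×_; _,_; proj₁; proj₂)
open import Data.Sum as Sum using (_⊎_; inj₁; inj₂)
open import Data.Vec as V using (Vec; []; _∷_; lookup)
import Data.Vec.Properties as Vecₚ
open import Function using (id; _∘_; flip; Equivalence)
open import Relation.Binary.Definitions using (tri<; tri≈; tri>)
open import Relation.Binary.PropositionalEquality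
open import Relation.Nullary using (Dec; yes; no; ¬_)
open import Relation.Nullary.Decidable using (T?; map′; _×-dec_)

private
  variable
    A : Set

-- Boolean reflection

true⇒T : ∀ {b} → b ≡ true → T b
true⇒T = Equivalence.from T-≡

T⇒true : ∀ {b} → T b → b ≡ true
T⇒true = Equivalence.to T-≡

true≢false : ∀ {b} → b ≡ true → b ≡ false → ⊥
true≢false refl ()

∧-true⁻ : ∀ {a b} → a ∧ b ≡ true → (a ≡ true) × (b ≡ true)
∧-true⁻ {true} {true} _ = refl , refl

∧-true⁺ : ∀ {a b} → a ≡ true → b ≡ true → a ∧ b ≡ true
∧-true⁺ refl refl = refl

∨-true⁻ : ∀ {a b} → a ∨ b ≡ true → (a ≡ true) ⊎ (b ≡ true)
∨-true⁻ {true}  _ = inj₁ refl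
∨-true⁻ {false} e = inj₂ e

∨-true⁺ˡ : ∀ {a b} → a ≡ true → a ∨ b ≡ true
∨-true⁺ˡ refl = refl

∨-true⁺ʳ : ∀ {a b} → b ≡ true → a ∨ b ≡ true
∨-true⁺ʳ {true}  _ = refl
∨-true⁺ʳ {false} e = e

not-true⇒false : ∀ {a} → not a ≡ true → a ≡ false
not-true⇒false {false} _ = refl

≡ᵇ-true⇒≡ : ∀ {m n} → (m ≡ᵇ n) ≡ true → m ≡ n
≡ᵇ-true⇒≡ {m} {n} e = ≡ᵇ⇒≡ m n (true⇒T e)

≡ᵇ-refl : ∀ m → (m ≡ᵇ m) ≡ true
≡ᵇ-refl m = T⇒true (≡⇒≡ᵇ m m refl)

≤ᵇ-true⇒≤ : ∀ {m n} → (m ≤ᵇ n) ≡ true → m ≤ n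
≤ᵇ-true⇒≤ {m} {n} e = ≤ᵇ⇒≤ m n (true⇒T e)

≤⇒≤ᵇ-true : ∀ {m n} → m ≤ n → (m ≤ᵇ n) ≡ true
≤⇒≤ᵇ-true m≤n = T⇒true (≤⇒≤ᵇ m≤n)

<ᵇ-true⇒< : ∀ {m n} → (m <ᵇ n) ≡ true → m < n
<ᵇ-true⇒< {m} {n} e = <ᵇ⇒< m n (true⇒T e)

<⇒<ᵇ-true : ∀ {m n} → m < n → (m <ᵇ n) ≡ true
<⇒<ᵇ-true m<n = T⇒true (<⇒<ᵇ m<n)

module _ (p : A → Bool) where

  any-true⁻ : ∀ xs → any p xs ≡ true → ∃ λ x → x ∈ xs × p x ≡ true
  any-true⁻ xs e = Product.map₂ (Product.map₂ T⇒true) (find (any⁻ p xs (true⇒T e)))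

  any-true⁺ : ∀ {x xs} → x ∈ xs → p x ≡ true → any p xs ≡ true
  any-true⁺ x∈xs px = T⇒true (any⁺ p (lose x∈xs (true⇒T px)))

  all-true⁻ : ∀ {x} xs → all p xs ≡ true → x ∈ xs → p x ≡ true
  all-true⁻ xs e x∈xs = T⇒true (All.lookup (all⁺ p xs (true⇒T e)) x∈xs)

  all-true⁺ : ∀ xs → (∀ {x} → x ∈ xs → p x ≡ true) → all p xs ≡ true
  all-true⁺ xs h = T⇒true (all⁻ p (All.tabulate (true⇒T ∘ h)))

  ∈-filterᵇ⁻ : ∀ {x} xs → x ∈ filterᵇ p xs → x ∈ xs × p x ≡ true
  ∈-filterᵇ⁻ xs x∈ = Product.map₂ T⇒true (∈-filter⁻ (T? ∘ p) {xs = xs} x∈)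

  ∈-filterᵇ⁺ : ∀ {x} xs → x ∈ xs → p x ≡ true → x ∈ filterᵇ p xs
  ∈-filterᵇ⁺ xs x∈xs px = ∈-filter⁺ (T? ∘ p) x∈xs (true⇒T px)

-- Index complexity

∈-allVecs : ∀ {p} (x : Vec Bool p) → x ∈ allVecs p
∈-allVecs []          = here refl
∈-allVecs (true ∷ x)  = ∈-++⁺ˡ (∈-map⁺ (true ∷_) (∈-allVecs x))
∈-allVecs (false ∷ x) = ∈-++⁺ʳ _ (∈-map⁺ (false ∷_) (∈-allVecs x))

wt≤length : ∀ {p} (x : Vec Bool p) → wt x ≤ p
wt≤length []          = z≤n
wt≤length (true ∷ x)  = s≤s (wt≤length x)
wt≤length (false ∷ x) = m≤n⇒m≤1+n (wt≤length x)

bitEq-true⇒≡ : ∀ {x y} → ((x ∧ y) ∨ (not x ∧ not y)) ≡ true → x ≡ y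
bitEq-true⇒≡ {true}  {true}  _ = refl
bitEq-true⇒≡ {false} {false} _ = refl

eqBits-true⇒≡ : ∀ xs ys → eqBits xs ys ≡ true → xs ≡ ys
eqBits-true⇒≡ []       []       _ = refl
eqBits-true⇒≡ (x ∷ xs) (y ∷ ys) e =
  let x≡y , xs≡ys = ∧-true⁻ e in cong₂ _∷_ (bitEq-true⇒≡ x≡y) (eqBits-true⇒≡ xs ys xs≡ys)

eqBits-refl : ∀ xs → eqBits xs xs ≡ true
eqBits-refl []           = refl
eqBits-refl (true ∷ xs)  = eqBits-refl xs
eqBits-refl (false ∷ xs) = eqBits-refl xs

eqVec-true⇒≡ : ∀ {p} (x y : Vec Bool p) → eqVec x y ≡ true → x ≡ y
eqVec-true⇒≡ []      []      _ = refl
eqVec-true⇒≡ (a ∷ x) (b ∷ y) e =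
  let a≡b , x≡y = ∧-true⁻ e in cong₂ _∷_ (bitEq-true⇒≡ a≡b) (eqVec-true⇒≡ x y x≡y)

eqVec-refl : ∀ {p} (x : Vec Bool p) → eqVec x x ≡ true
eqVec-refl x = eqBits-refl (V.toList x)

Separates : ∀ {p} → BSet p → (I a : Vec Bool p) → Set
Separates T I a = T a ≡ true × (∀ b → T b ≡ true → restrict I b ≡ restrict I a → b ≡ a)

separates⇒Separates : ∀ {p} (T : BSet p) I a → separates T I a ≡ true → Separates T I a
separates⇒Separates {p} T I a e = Ta , λ b Tb b≈a → unique b Tb b≈a (∨-true⁻ (all-true⁻ _ _ others (∈-allVecs b)))
  where
  Ta = proj₁ (∧-true⁻ e)
  others = proj₂ (∧-true⁻ e)
  unique : ∀ b → T b ≡ true → restrict I b ≡ restrict I a →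
           (not (T b) ≡ true) ⊎ ((eqVec b a ∨ not (eqBits (restrict I b) (restrict I a))) ≡ true) → b ≡ a
  unique b Tb _   (inj₁ ¬Tb) = ⊥-elim (true≢false Tb (not-true⇒false ¬Tb))
  unique b Tb b≈a (inj₂ h) with ∨-true⁻ {eqVec b a} h
  ... | inj₁ b≡a  = eqVec-true⇒≡ b a b≡a
  ... | inj₂ b≉a = ⊥-elim (true≢false (subst (λ r → eqBits r (restrict I a) ≡ true) (sym b≈a) (eqBits-refl (restrict I a)))
                                       (not-true⇒false b≉a))

Separates⇒separates : ∀ {p} (T : BSet p) I a → Separates T I a → separates T I a ≡ true
Separates⇒separates {p} T I a (Ta , unique) = ∧-true⁺ Ta (all-true⁺ _ (allVecs p) λ {b} _ → other b)
  where
  other : ∀ b → (not (T b) ∨ eqVec b a ∨ not (eqBits (restrict I b) (restrict I a))) ≡ true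
  other b with T b in Tb | eqBits (restrict I b) (restrict I a) in b≈a
  ... | false | _     = refl
  ... | true  | false = ∨-true⁺ʳ {eqVec b a} refl
  ... | true  | true  rewrite unique b Tb (eqBits-true⇒≡ _ _ b≈a) | eqVec-refl a = refl

minList-≤ : ∀ d {x} xs → x ∈ xs → minList d xs ≤ x
minList-≤ d (y ∷ xs) (here refl) = m⊓n≤m y (minList d xs)
minList-≤ d (y ∷ xs) (there x∈) = ≤-trans (m⊓n≤n y (minList d xs)) (minList-≤ d xs x∈)

≤-minList : ∀ {X} d xs → X ≤ d → (∀ {x} → x ∈ xs → X ≤ x) → X ≤ minList d xs
≤-minList d []       X≤d _ = X≤d
≤-minList d (y ∷ xs) X≤d h = ⊓-glb (h (here refl)) (≤-minList d xs X≤d (h ∘ there))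

indexComplexity-≤ : ∀ {p} (T : BSet p) I a → Separates T I a → indexComplexity p T ≤ wt I
indexComplexity-≤ {p} T I a sep = minList-≤ p _ (∈-map⁺ wt (∈-filterᵇ⁺ _ (allVecs p) (∈-allVecs I)
  (any-true⁺ (separates T I) (∈-allVecs a) (Separates⇒separates T I a sep))))

≤-indexComplexity : ∀ {p} (T : BSet p) X → X ≤ p → (∀ I a → Separates T I a → X ≤ wt I) →
                    X ≤ indexComplexity p T
≤-indexComplexity {p} T X X≤p h = ≤-minList p (L.map wt (filterᵇ (λ I → any (separates T I) (allVecs p)) (allVecs p))) X≤p λ x∈ →
  let I , I∈ , x≡wtI = ∈-map⁻ wt x∈
      a , _ , sep = any-true⁻ (separates T I) (allVecs p) (proj₂ (∈-filterᵇ⁻ (λ I → any (separates T I) (allVecs p)) (allVecs p) I∈))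
  in subst (X ≤_) (sym x≡wtI) (h I a (separates⇒Separates T I a sep))

-- Peripheral and outer intervals

HasWeight : ∀ {p} → BSet p → ℕ → Set
HasWeight {p} R w = ∃ λ (y : Vec Bool p) → (R y ≡ true) × (wt y ≡ w)

∈weights⇒HasWeight : ∀ p (R : BSet p) {w} → w ∈ weights p R → HasWeight R w
∈weights⇒HasWeight p R {w} w∈ =
  let _ , e = ∈-filterᵇ⁻ (λ w → any (λ x → R x ∧ (wt x ≡ᵇ w)) (allVecs p)) (upTo (suc p)) w∈
      y , _ , Ry∧wy = any-true⁻ (λ x → R x ∧ (wt x ≡ᵇ w)) (allVecs p) e
      Ry , wy = ∧-true⁻ Ry∧wy
  in y , Ry , ≡ᵇ-true⇒≡ wy

HasWeight⇒∈weights : ∀ p (R : BSet p) {w} → HasWeight R w → w ∈ weights p R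
HasWeight⇒∈weights p R (y , Ry , refl) =
  ∈-filterᵇ⁺ (λ w → any (λ x → R x ∧ (wt x ≡ᵇ w)) (allVecs p)) (upTo (suc p)) (∈-upTo⁺ (s≤s (wt≤length y)))
    (any-true⁺ (λ x → R x ∧ (wt x ≡ᵇ wt y)) (∈-allVecs y) (∧-true⁺ Ry (≡ᵇ-refl (wt y))))

HasWeight? : ∀ p (R : BSet p) w → Dec (HasWeight R w)
HasWeight? p R w = map′ (∈weights⇒HasWeight p R) (HasWeight⇒∈weights p R) (w ∈? weights p R)

width : ℕ × ℕ → ℕ
width (s , c) = s + c

validPI⇒bounds : ∀ p s c → validPI p (s , c) ≡ true → (s ≤ p) × (c ≤ p) × (s + c ≤ suc p)
validPI⇒bounds p s c e =
  let s≤p , rest = ∧-true⁻ e ; c≤p , s+c≤1+p = ∧-true⁻ {c ≤ᵇ p} rest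
  in ≤ᵇ-true⇒≤ s≤p , ≤ᵇ-true⇒≤ c≤p , ≤ᵇ-true⇒≤ s+c≤1+p

bounds⇒validPI : ∀ p s c → s ≤ p → c ≤ p → s + c ≤ suc p → validPI p (s , c) ≡ true
bounds⇒validPI p s c s≤p c≤p s+c≤1+p = ∧-true⁺ (≤⇒≤ᵇ-true s≤p) (∧-true⁺ (≤⇒≤ᵇ-true c≤p) (≤⇒≤ᵇ-true s+c≤1+p))

inPI⇒⊎ : ∀ p s c w → inPI p (s , c) w ≡ true → (w < s) ⊎ (p < w + c)
inPI⇒⊎ p s c w e = Sum.map <ᵇ-true⇒< <ᵇ-true⇒< (∨-true⁻ {w <ᵇ s} e)

<⇒inPI : ∀ p s c w → w < s → inPI p (s , c) w ≡ true
<⇒inPI p s c w w<s = ∨-true⁺ˡ (<⇒<ᵇ-true w<s)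

>⇒inPI : ∀ p s c w → p < w + c → inPI p (s , c) w ≡ true
>⇒inPI p s c w p<w+c = ∨-true⁺ʳ {w <ᵇ s} (<⇒<ᵇ-true p<w+c)

containsPI⇒inPI : ∀ p (R : BSet p) sc → containsPI p R sc ≡ true → ∀ {w} → HasWeight R w → inPI p sc w ≡ true
containsPI⇒inPI p R sc e h = all-true⁻ (inPI p sc) (weights p R) e (HasWeight⇒∈weights p R h)

inPI⇒containsPI : ∀ p (R : BSet p) sc → (∀ {w} → HasWeight R w → inPI p sc w ≡ true) → containsPI p R sc ≡ true
inPI⇒containsPI p R sc h = all-true⁺ (inPI p sc) (weights p R) (h ∘ ∈weights⇒HasWeight p R)

Covers : ∀ p → BSet p → ℕ × ℕ → Set
Covers p R sc = (validPI p sc ≡ true) × (containsPI p R sc ≡ true)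

covers-everything : ∀ p (R : BSet (suc p)) → Covers (suc p) R (suc p , 1)
covers-everything p R =
  bounds⇒validPI (suc p) (suc p) 1 ≤-refl (s≤s z≤n) (≤-reflexive (+-comm (suc p) 1)) ,
  inPI⇒containsPI (suc p) R (suc p , 1) λ { (y , _ , refl) → inside (wt≤length y) }
  where
  inside : ∀ {w} → w ≤ suc p → inPI (suc p) (suc p , 1) w ≡ true
  inside {w} w≤1+p with m≤n⇒m<n∨m≡n w≤1+p
  ... | inj₁ w<1+p = <⇒inPI (suc p) (suc p) 1 w w<1+p
  ... | inj₂ refl  = >⇒inPI (suc p) (suc p) 1 w (≤-reflexive (+-comm 1 w))

∈-allPI : ∀ p s c → validPI p (s , c) ≡ true → (s , c) ∈ allPI p
∈-allPI p s c valid =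
  let s≤p , c≤p , _ = validPI⇒bounds p s c valid in
  ∈-filterᵇ⁺ (validPI p) (concatMap (λ s → L.map (s ,_) (upTo (suc p))) (upTo (suc p)))
    (∈-concatMap⁺ (λ s → L.map (s ,_) (upTo (suc p)))
      (Any.map (λ { refl → ∈-map⁺ (s ,_) (∈-upTo⁺ (s≤s c≤p)) }) (∈-upTo⁺ {i = s} (s≤s s≤p))))
    valid

∈-allPI⇒valid : ∀ p {sc} → sc ∈ allPI p → validPI p sc ≡ true
∈-allPI⇒valid p sc∈ = proj₂ (∈-filterᵇ⁻ (validPI p) (concatMap (λ s → L.map (s ,_) (upTo (suc p))) (upTo (suc p))) sc∈)

better⇒≤ : ∀ x y → better x y ≡ true → width x ≤ width y
better⇒≤ (s , c) (s' , c') e with ∨-true⁻ {(s + c) <ᵇ (s' + c')} e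
... | inj₁ lt = <⇒≤ (<ᵇ-true⇒< lt)
... | inj₂ eq = ≤-reflexive (≡ᵇ-true⇒≡ (proj₁ (∧-true⁻ eq)))

¬better⇒≥ : ∀ x y → better x y ≡ false → width y ≤ width x
¬better⇒≥ (s , c) (s' , c') e with (s + c) <ᵇ (s' + c') in lt
... | false = ≮⇒≥ (λ x<y → true≢false (<⇒<ᵇ-true x<y) lt)

bestOf-nonempty : ∀ {x} xs → x ∈ xs → ∃ λ y → bestOf xs ≡ just y
bestOf-nonempty (a ∷ xs) _ with bestOf xs
... | nothing = a , refl
... | just y with better a y
...   | true  = a , refl
...   | false = y , refl

bestOf-minimal : ∀ xs {y} → bestOf xs ≡ just y → (y ∈ xs) × (∀ {x} → x ∈ xs → width y ≤ width x)
bestOf-minimal (x ∷ xs) e with bestOf xs in best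
bestOf-minimal (x ∷ xs) refl | nothing =
  here refl , λ { (here refl) → ≤-refl ; (there x'∈) → ⊥-elim (nothing≢just (proj₂ (bestOf-nonempty xs x'∈))) }
  where
  nothing≢just : ∀ {y} → bestOf xs ≡ just y → ⊥
  nothing≢just e with () ← trans (sym best) e
... | just y with bestOf-minimal xs best | better x y in x<y
bestOf-minimal (x ∷ xs) refl | just y | _   , y≤ | true  =
  here refl , λ { (here refl) → ≤-refl ; (there x'∈) → ≤-trans (better⇒≤ x y x<y) (y≤ x'∈) }
bestOf-minimal (x ∷ xs) refl | just y | y∈ , y≤ | false =
  there y∈ , λ { (here refl) → ¬better⇒≥ x y x<y ; (there x'∈) → y≤ x'∈ }

outint-covers-minimally : ∀ p (R : BSet p) {sc} → Covers p R sc →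
                          Covers p R (outint p R) × (∀ {sc'} → Covers p R sc' → width (outint p R) ≤ width sc')
outint-covers-minimally p R {s , c} (valid , contains)
  with bestOf-nonempty (filterᵇ (containsPI p R) (allPI p))
         (∈-filterᵇ⁺ (containsPI p R) (allPI p) (∈-allPI p s c valid) contains)
... | y , best rewrite best =
  let y∈ , y≤ = bestOf-minimal _ best
      y∈allPI , containsY = ∈-filterᵇ⁻ (containsPI p R) (allPI p) y∈
  in (∈-allPI⇒valid p y∈allPI , containsY) ,
     λ { {s' , c'} (valid' , contains') → y≤ (∈-filterᵇ⁺ (containsPI p R) (allPI p) (∈-allPI p s' c' valid') contains') }

outint-covers : ∀ p (R : BSet p) sc → Covers p R sc → Covers p R (outint p R)
outint-covers p R sc cover = proj₁ (outint-covers-minimally p R {sc} cover)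

outint-minimal : ∀ p (R : BSet p) sc → Covers p R sc → width (outint p R) ≤ width sc
outint-minimal p R sc cover = proj₂ (outint-covers-minimally p R {sc} cover) {sc} cover

-- outint falls back to (0 , 0) when no peripheral interval contains R.
outint-default-or-valid : ∀ p (R : BSet p) → (outint p R ≡ (0 , 0)) ⊎ (validPI p (outint p R) ≡ true)
outint-default-or-valid p R with bestOf (filterᵇ (containsPI p R) (allPI p)) in best
... | nothing = inj₁ refl
... | just y  = inj₂ (∈-allPI⇒valid p (proj₁ (∈-filterᵇ⁻ (containsPI p R) (allPI p) (proj₁ (bestOf-minimal _ best)))))

out-≤ : ∀ p (R : BSet p) → out p R ≤ p
out-≤ p R with outint-default-or-valid p R
... | inj₁ e rewrite e = z≤n
... | inj₂ valid with outint p R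
...   | (s , c) = ∸-monoˡ-≤ 1 (proj₂ (proj₂ (validPI⇒bounds p s c valid)))

out-cong : ∀ p {R R′ : BSet p} → outint p R ≡ outint p R′ → out p R ≡ out p R′
out-cong p = cong (λ (s , c) → s + c ∸ 1)

out-≤-cover : ∀ p (R : BSet p) s c → Covers p R (s , c) → out p R ≤ s + c ∸ 1
out-≤-cover p R s c cover = ∸-monoˡ-≤ 1 (outint-minimal p R (s , c) cover)

-- Words agreeing on an index set

onesOn : ∀ {p} → Vec Bool p → Vec Bool p → ℕ
onesOn []          []          = 0
onesOn (true ∷ I)  (true ∷ a)  = suc (onesOn I a)
onesOn (true ∷ I)  (false ∷ a) = onesOn I a
onesOn (false ∷ I) (_ ∷ a)     = onesOn I a

zerosOn : ∀ {p} → Vec Bool p → Vec Bool p → ℕ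
zerosOn []          []          = 0
zerosOn (true ∷ I)  (true ∷ a)  = zerosOn I a
zerosOn (true ∷ I)  (false ∷ a) = suc (zerosOn I a)
zerosOn (false ∷ I) (_ ∷ a)     = zerosOn I a

wt≡onesOn+zerosOn : ∀ {p} (I a : Vec Bool p) → wt I ≡ onesOn I a + zerosOn I a
wt≡onesOn+zerosOn []          []          = refl
wt≡onesOn+zerosOn (true ∷ I)  (true ∷ a)  = cong suc (wt≡onesOn+zerosOn I a)
wt≡onesOn+zerosOn (true ∷ I)  (false ∷ a) = trans (cong suc (wt≡onesOn+zerosOn I a)) (sym (+-suc (onesOn I a) (zerosOn I a)))
wt≡onesOn+zerosOn (false ∷ I) (_ ∷ a)     = wt≡onesOn+zerosOn I a

onesOn+zerosOn≤length : ∀ {p} (I a : Vec Bool p) → onesOn I a + zerosOn I a ≤ p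
onesOn+zerosOn≤length I a = ≤-trans (≤-reflexive (sym (wt≡onesOn+zerosOn I a))) (wt≤length I)

length-restrict : ∀ {p} (I a : Vec Bool p) → L.length (restrict I a) ≡ wt I
length-restrict []          []      = refl
length-restrict (true ∷ I)  (_ ∷ a) = cong suc (length-restrict I a)
length-restrict (false ∷ I) (_ ∷ a) = length-restrict I a

agreeing-wt-bounds : ∀ {p} (I a b : Vec Bool p) → restrict I b ≡ restrict I a →
                     (onesOn I a ≤ wt b) × (wt b + zerosOn I a ≤ p)
agreeing-wt-bounds [] [] [] _ = z≤n , z≤n
agreeing-wt-bounds (true ∷ I) (_ ∷ a) (_ ∷ b) e with ∷-injectiveˡ e | agreeing-wt-bounds I a b (∷-injectiveʳ e)
agreeing-wt-bounds (true ∷ I) (true ∷ a)  (true ∷ b)  e | refl | o , z = s≤s o , s≤s z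
agreeing-wt-bounds (true ∷ I) (false ∷ a) (false ∷ b) e | refl | o , z = o , ≤-trans (≤-reflexive (+-suc (wt b) (zerosOn I a))) (s≤s z)
agreeing-wt-bounds (false ∷ I) (_ ∷ a) (true ∷ b) e =
  let o , z = agreeing-wt-bounds I a b e in m≤n⇒m≤1+n o , s≤s z
agreeing-wt-bounds (false ∷ I) (_ ∷ a) (false ∷ b) e =
  let o , z = agreeing-wt-bounds I a b e in o , m≤n⇒m≤1+n z

agreeing-word-of-wt : ∀ {p} (I a : Vec Bool p) w → onesOn I a ≤ w → w + zerosOn I a ≤ p →
                      ∃ λ b → (restrict I b ≡ restrict I a) × (wt b ≡ w)
agreeing-word-of-wt [] [] w _ w≤0 = [] , refl , sym (n≤0⇒n≡0 (≤-trans (≤-reflexive (sym (+-identityʳ w))) w≤0))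
agreeing-word-of-wt (true ∷ I) (true ∷ a) (suc w) (s≤s o) (s≤s z) =
  let b , b≈a , wb = agreeing-word-of-wt I a w o z in true ∷ b , cong (true ∷_) b≈a , cong suc wb
agreeing-word-of-wt (true ∷ I) (false ∷ a) w o z =
  let b , b≈a , wb = agreeing-word-of-wt I a w o (≤-pred (≤-trans (≤-reflexive (sym (+-suc w (zerosOn I a)))) z))
  in false ∷ b , cong (false ∷_) b≈a , wb
agreeing-word-of-wt {suc p} (false ∷ I) (y ∷ a) w o z with (w + zerosOn I a) ≤? p
... | yes fits = let b , b≈a , wb = agreeing-word-of-wt I a w o fits in false ∷ b , b≈a , wb
... | no full = fill w o (≤-antisym z (≰⇒> full))
  where
  fill : ∀ w → onesOn I a ≤ w → w + zerosOn I a ≡ suc p →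
         ∃ λ b → (restrict (false ∷ I) b ≡ restrict (false ∷ I) (y ∷ a)) × (wt b ≡ w)
  fill zero o e = ⊥-elim (<-irrefl refl (≤-trans (s≤s (≤-trans (m≤n+m (zerosOn I a) (onesOn I a)) (onesOn+zerosOn≤length I a)))
                                                (≤-reflexive (sym e))))
  fill (suc w) o e =
    let o' = +-cancelʳ-≤ (zerosOn I a) (onesOn I a) w (≤-trans (onesOn+zerosOn≤length I a) (≤-reflexive (sym (suc-injective e))))
        b , b≈a , wb = agreeing-word-of-wt I a w o' (≤-reflexive (suc-injective e))
    in true ∷ b , b≈a , cong suc wb

another-agreeing-word : ∀ {p} (I a : Vec Bool p) → onesOn I a < wt a → wt a + zerosOn I a < p →
                        ∃ λ b → (restrict I b ≡ restrict I a) × (wt b ≡ wt a) × (b ≢ a)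
another-agreeing-word (true ∷ I) (true ∷ a) (s≤s o) (s≤s z) =
  let b , b≈a , wb , b≢a = another-agreeing-word I a o z
  in true ∷ b , cong (true ∷_) b≈a , cong suc wb , b≢a ∘ Vecₚ.∷-injectiveʳ
another-agreeing-word (true ∷ I) (false ∷ a) o z =
  let b , b≈a , wb , b≢a = another-agreeing-word I a o (≤-pred (≤-trans (≤-reflexive (sym (+-suc (suc (wt a)) (zerosOn I a)))) z))
  in false ∷ b , cong (false ∷_) b≈a , wb , b≢a ∘ Vecₚ.∷-injectiveʳ
another-agreeing-word {suc p} (false ∷ I) (true ∷ a) o (s≤s z) with onesOn I a <? wt a
... | yes o' = let b , b≈a , wb , b≢a = another-agreeing-word I a o' z in true ∷ b , b≈a , cong suc wb , b≢a ∘ Vecₚ.∷-injectiveʳ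
... | no ¬o' =
  let wa≡ = ≤-antisym (≮⇒≥ ¬o') (proj₁ (agreeing-wt-bounds I a a refl))
      b , b≈a , wb = agreeing-word-of-wt I a (suc (wt a)) (≤-trans (≤-reflexive (sym wa≡)) (n≤1+n _)) z
  in false ∷ b , b≈a , wb , λ ()
another-agreeing-word {suc p} (false ∷ I) (false ∷ a) o z with (wt a + zerosOn I a) <? p
... | yes z' = let b , b≈a , wb , b≢a = another-agreeing-word I a o z' in false ∷ b , b≈a , wb , b≢a ∘ Vecₚ.∷-injectiveʳ
... | no ¬z' = raise (wt a) refl o
  where
  full : wt a + zerosOn I a ≡ p
  full = ≤-antisym (≤-pred z) (≮⇒≥ ¬z')
  raise : ∀ m → wt a ≡ m → onesOn I a < m →
          ∃ λ b → (restrict (false ∷ I) b ≡ restrict (false ∷ I) (false ∷ a)) × (wt b ≡ wt a) × (b ≢ false ∷ a)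
  raise (suc m) wa≡ (s≤s o') =
    let b , b≈a , wb = agreeing-word-of-wt I a m o'
          (≤-trans (n≤1+n _) (≤-trans (≤-reflexive (cong (_+ zerosOn I a) (sym wa≡))) (≤-reflexive full)))
    in true ∷ b , b≈a , trans (cong suc wb) (sym wa≡) , λ ()

pattern-with-counts : ∀ {p} (a : Vec Bool p) u v → u ≤ wt a → v + wt a ≤ p →
                      ∃ λ I → (onesOn I a ≡ u) × (zerosOn I a ≡ v)
pattern-with-counts [] zero zero _ _ = [] , refl , refl
pattern-with-counts (true ∷ a) (suc u) v (s≤s u≤) v+≤ =
  let I , o , z = pattern-with-counts a u v u≤ (≤-pred (≤-trans (≤-reflexive (sym (+-suc v (wt a)))) v+≤))
  in true ∷ I , cong suc o , z
pattern-with-counts (true ∷ a) zero v _ v+≤ =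
  let I , o , z = pattern-with-counts a zero v z≤n (≤-pred (≤-trans (≤-reflexive (sym (+-suc v (wt a)))) v+≤))
  in false ∷ I , o , z
pattern-with-counts (false ∷ a) u (suc v) u≤ (s≤s v+≤) =
  let I , o , z = pattern-with-counts a u v u≤ v+≤ in true ∷ I , o , cong suc z
pattern-with-counts (false ∷ a) u zero u≤ _ =
  let I , o , z = pattern-with-counts a u zero u≤ (wt≤length a) in false ∷ I , o , z

agreeing-extremal⇒≡ : ∀ {p} (I a b : Vec Bool p) → restrict I b ≡ restrict I a → wt b ≡ wt a →
                      (wt a ≡ onesOn I a) ⊎ (wt a + zerosOn I a ≡ p) → b ≡ a
agreeing-extremal⇒≡ [] [] [] _ _ _ = refl
agreeing-extremal⇒≡ (true ∷ I) (_ ∷ a) (_ ∷ b) e w h with ∷-injectiveˡ e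
agreeing-extremal⇒≡ (true ∷ I) (true ∷ a) (true ∷ b) e w h | refl =
  cong (true ∷_) (agreeing-extremal⇒≡ I a b (∷-injectiveʳ e) (suc-injective w) (Sum.map suc-injective suc-injective h))
agreeing-extremal⇒≡ (true ∷ I) (false ∷ a) (false ∷ b) e w h | refl =
  cong (false ∷_) (agreeing-extremal⇒≡ I a b (∷-injectiveʳ e) w
    (Sum.map₂ (λ h → suc-injective (trans (sym (+-suc (wt a) (zerosOn I a))) h)) h))
agreeing-extremal⇒≡ (false ∷ I) (y ∷ a) (x ∷ b) e w (inj₁ h) = lowest y x w h
  where
  lowest : ∀ y x → wt (x ∷ b) ≡ wt (y ∷ a) → wt (y ∷ a) ≡ onesOn I a → x ∷ b ≡ y ∷ a
  lowest true  _     _ h = ⊥-elim (<-irrefl refl (≤-trans (s≤s (proj₁ (agreeing-wt-bounds I a a refl))) (≤-reflexive h)))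
  lowest false true  w h = ⊥-elim (<-irrefl refl (≤-trans (s≤s (proj₁ (agreeing-wt-bounds I a b e))) (≤-reflexive (trans w h))))
  lowest false false w h = cong (false ∷_) (agreeing-extremal⇒≡ I a b e w (inj₁ h))
agreeing-extremal⇒≡ {suc p} (false ∷ I) (y ∷ a) (x ∷ b) e w (inj₂ h) = highest y x w h
  where
  highest : ∀ y x → wt (x ∷ b) ≡ wt (y ∷ a) → wt (y ∷ a) + zerosOn I a ≡ suc p → x ∷ b ≡ y ∷ a
  highest false _     _ h = ⊥-elim (<-irrefl refl (≤-trans (≤-reflexive (sym h)) (proj₂ (agreeing-wt-bounds I a a refl))))
  highest true  false w h = ⊥-elim (<-irrefl refl (≤-trans (≤-reflexive (trans (sym h) (cong (_+ zerosOn I a) (sym w))))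
                                                          (proj₂ (agreeing-wt-bounds I a b e))))
  highest true  true  w h = cong (true ∷_) (agreeing-extremal⇒≡ I a b e (suc-injective w) (inj₂ (suc-injective h)))

-- The symmetric case: r_p(R) = out_p(R)

inPI⇒∉window : ∀ p s c w → inPI p (s , c) w ≡ true → s ≤ w → w + c ≤ p → ⊥
inPI⇒∉window p s c w inside s≤w w+c≤p with inPI⇒⊎ p s c w inside
... | inj₁ w<s   = <-irrefl refl (<-≤-trans w<s s≤w)
... | inj₂ p<w+c = <-irrefl refl (<-≤-trans p<w+c w+c≤p)

-- If the only weight of R in the window [u , p - v] is one of its endpoints,
-- moving that endpoint out of the window gives a peripheral interval of size u + v + 1.
out-≤-isolated : ∀ p (R : BSet p) u v t → (t ≡ u) ⊎ (t + v ≡ p) →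
                 (∀ {w} → HasWeight R w → u ≤ w → w + v ≤ p → w ≡ t) → out p R ≤ u + v
out-≤-isolated p R u v t endpoint isolated with p ≤? u + v
... | yes p≤u+v = ≤-trans (out-≤ p R) p≤u+v
... | no p≰u+v with endpoint
...   | inj₁ refl = out-≤-cover p R (suc u) v (valid , inPI⇒containsPI p R (suc u , v) λ {w} → contained w)
  where
  u+v<p = ≰⇒> p≰u+v
  valid = bounds⇒validPI p (suc u) v (≤-<-trans (m≤m+n u v) u+v<p) (≤-trans (m≤n+m v u) (<⇒≤ u+v<p)) (s≤s (<⇒≤ u+v<p))
  contained : ∀ w → HasWeight R w → inPI p (suc u , v) w ≡ true
  contained w h with w ≤? u | (w + v) ≤? p
  ... | yes w≤u | _         = <⇒inPI p (suc u) v w (s≤s w≤u)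
  ... | no w≰u  | yes w+v≤p = ⊥-elim (w≰u (≤-reflexive (isolated h (<⇒≤ (≰⇒> w≰u)) w+v≤p)))
  ... | no _    | no w+v≰p  = >⇒inPI p (suc u) v w (≰⇒> w+v≰p)
...   | inj₂ t+v≡p = ≤-trans (out-≤-cover p R u (suc v) (valid , inPI⇒containsPI p R (u , suc v) λ {w} → contained w))
                             (≤-reflexive (cong (_∸ 1) (+-suc u v)))
  where
  u+v<p = ≰⇒> p≰u+v
  valid = bounds⇒validPI p u (suc v) (≤-trans (m≤m+n u v) (<⇒≤ u+v<p)) (≤-<-trans (m≤n+m v u) u+v<p)
                         (≤-trans (≤-reflexive (+-suc u v)) (s≤s (<⇒≤ u+v<p)))
  contained : ∀ w → HasWeight R w → inPI p (u , suc v) w ≡ true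
  contained w h with suc w ≤? u | (w + v) ≤? p
  ... | yes w<u | _         = <⇒inPI p u (suc v) w w<u
  ... | no w≮u  | yes w+v≤p = >⇒inPI p u (suc v) w (≤-reflexive (trans (cong suc (sym (trans (cong (_+ v) (isolated h (≮⇒≥ w≮u) w+v≤p)) t+v≡p)))
                                                                         (sym (+-suc w v))))
  ... | no _    | no w+v≰p  = >⇒inPI p u (suc v) w (≤-trans (≰⇒> w+v≰p) (≤-trans (n≤1+n _) (≤-reflexive (sym (+-suc w v)))))

shrink-low : ∀ p (R : BSet p) s c → Covers p R (suc s , c) → ¬ HasWeight R s → Covers p R (s , c)
shrink-low p R s c (valid , contains) s∉R =
  bounds⇒validPI p s c (≤-trans (n≤1+n s) s<p) c≤p (≤-trans (n≤1+n _) s+c<p) ,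
  inPI⇒containsPI p R (s , c) λ {w} h → lower w h (inPI⇒⊎ p (suc s) c w (containsPI⇒inPI p R (suc s , c) contains h))
  where
  bounds = validPI⇒bounds p (suc s) c valid
  s<p = proj₁ bounds
  c≤p = proj₁ (proj₂ bounds)
  s+c<p = proj₂ (proj₂ bounds)
  lower : ∀ w → HasWeight R w → (w < suc s) ⊎ (p < w + c) → inPI p (s , c) w ≡ true
  lower w h (inj₂ p<w+c) = >⇒inPI p s c w p<w+c
  lower w h (inj₁ w<1+s) with m≤n⇒m<n∨m≡n (≤-pred w<1+s)
  ... | inj₁ w<s  = <⇒inPI p s c w w<s
  ... | inj₂ refl = ⊥-elim (s∉R h)

shrink-high : ∀ p (R : BSet p) s c → Covers p R (s , suc c) → ¬ HasWeight R (p ∸ c) → Covers p R (s , c)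
shrink-high p R s c (valid , contains) top∉R =
  bounds⇒validPI p s c s≤p (≤-trans (n≤1+n c) c<p) (≤-trans (≤-trans (n≤1+n _) (≤-reflexive (sym (+-suc s c)))) s+c≤)  ,
  inPI⇒containsPI p R (s , c) λ {w} h → upper w h (inPI⇒⊎ p s (suc c) w (containsPI⇒inPI p R (s , suc c) contains h))
  where
  bounds = validPI⇒bounds p s (suc c) valid
  s≤p = proj₁ bounds
  c<p = proj₁ (proj₂ bounds)
  s+c≤ = proj₂ (proj₂ bounds)
  upper : ∀ w → HasWeight R w → (w < s) ⊎ (p < w + suc c) → inPI p (s , c) w ≡ true
  upper w h (inj₁ w<s) = <⇒inPI p s c w w<s
  upper w h (inj₂ p<w+1+c) with m≤n⇒m<n∨m≡n (≤-pred (≤-trans p<w+1+c (≤-reflexive (+-suc w c))))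
  ... | inj₁ p<w+c = >⇒inPI p s c w p<w+c
  ... | inj₂ p≡w+c = ⊥-elim (top∉R (subst (HasWeight R) (trans (sym (m+n∸n≡m w c)) (cong (_∸ c) (sym p≡w+c))) h))

-- The weights left out by outint Full form a window [u , p - v]. When R has the
-- same outer interval, an endpoint e of the window is a weight of R and the only
-- weight of Full in the window.
record Window (p : ℕ) (R Full : BSet p) : Set where
  field
    e u v    : ℕ
    e∈R      : HasWeight R e
    u≤e      : u ≤ e
    e+v≤p    : e + v ≤ p
    u+v≡out  : u + v ≡ out p Full
    endpoint : (e ≡ u) ⊎ (e + v ≡ p)
    isolated : ∀ {w} → HasWeight Full w → u ≤ w → w + v ≤ p → w ≡ e

window : ∀ p (R Full : BSet p) → (∃ λ y → R y ≡ true) → outint p R ≡ outint p Full → Window p R Full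
window zero R Full ([] , Ry) _ = record
  { e = 0 ; u = 0 ; v = 0 ; e∈R = [] , Ry , refl ; u≤e = z≤n ; e+v≤p = z≤n
  ; u+v≡out = sym (n≤0⇒n≡0 (out-≤ 0 Full)) ; endpoint = inj₁ refl ; isolated = λ { ([] , _ , refl) _ _ → refl } }
window (suc p) R Full (y , Ry) same = from (outint P R) refl
  where
  P = suc p
  coverR : ∀ {sc} → outint P R ≡ sc → Covers P R sc
  coverR refl = outint-covers P R (P , 1) (covers-everything p R)
  coverFull : ∀ {sc} → outint P R ≡ sc → containsPI P Full sc ≡ true
  coverFull eq = subst (λ sc → containsPI P Full sc ≡ true) (trans (sym same) eq)
                       (proj₂ (outint-covers P Full (P , 1) (covers-everything p Full)))
  not-minimal : ∀ {sc} sc' → outint P R ≡ sc → Covers P R sc' → width sc' < width sc → ⊥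
  not-minimal sc' refl cover' narrower = <-irrefl refl (<-≤-trans narrower (outint-minimal P R sc' cover'))
  from : ∀ sc → outint P R ≡ sc → Window P R Full
  from (suc s , c) eq with HasWeight? P R s
  ... | no s∉R = ⊥-elim (not-minimal (s , c) eq (shrink-low P R s c (coverR eq) s∉R) ≤-refl)
  ... | yes s∈R = record
    { e = s ; u = s ; v = c ; e∈R = s∈R ; u≤e = ≤-refl
    ; e+v≤p = ≤-pred (proj₂ (proj₂ (validPI⇒bounds P (suc s) c (proj₁ (coverR eq)))))
    ; u+v≡out = cong (λ (s , c) → s + c ∸ 1) (sym (trans (sym same) eq)) ; endpoint = inj₁ refl
    ; isolated = λ {w} h s≤w w+c≤P → ≤-antisym (≮⇒≥ (λ s<w → inPI⇒∉window P (suc s) c w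
                     (containsPI⇒inPI P Full (suc s , c) (coverFull eq) h) s<w w+c≤P)) s≤w }
  from (zero , suc c) eq with HasWeight? P R (P ∸ c)
  ... | no top∉R = ⊥-elim (not-minimal (0 , c) eq (shrink-high P R 0 c (coverR eq) top∉R) ≤-refl)
  ... | yes top∈R = record
    { e = P ∸ c ; u = 0 ; v = c ; e∈R = top∈R ; u≤e = z≤n ; e+v≤p = ≤-reflexive top+c≡P
    ; u+v≡out = cong (λ (s , c) → s + c ∸ 1) (sym (trans (sym same) eq)) ; endpoint = inj₂ top+c≡P
    ; isolated = λ {w} h _ w+c≤P → +-cancelʳ-≡ c w (P ∸ c) (trans (≤-antisym w+c≤P (≮⇒≥ (λ w+c<P → inPI⇒∉window P 0 (suc c) w
                     (containsPI⇒inPI P Full (0 , suc c) (coverFull eq) h) z≤n (≤-trans (≤-reflexive (+-suc w c)) w+c<P))))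
                     (sym top+c≡P)) }
    where
    top+c≡P : P ∸ c + c ≡ P
    top+c≡P = m∸n+n≡m (≤-trans (n≤1+n c) (proj₁ (proj₂ (validPI⇒bounds P 0 (suc c) (proj₁ (coverR eq))))))
  from (zero , zero) eq = ⊥-elim (inPI⇒∉window P 0 0 (wt y) (containsPI⇒inPI P R (0 , 0) (proj₂ (coverR eq)) (y , Ry , refl))
                            z≤n (≤-trans (≤-reflexive (+-identityʳ (wt y))) (wt≤length y)))

-- I fixes u ones and v zeros of a, so every word agreeing with a on I has its
-- weight in the window, hence weight e; as e is an endpoint, it is a itself.
window-separator : ∀ {p} {R Full : BSet p} (W : Window p R Full) (a : Vec Bool p) → wt a ≡ Window.e W →
                   ∃ λ I → (wt I ≡ out p Full) × (∀ b → HasWeight Full (wt b) → restrict I b ≡ restrict I a → b ≡ a)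
window-separator {p} W a wa≡e =
  I , trans (wt≡onesOn+zerosOn I a) (trans (cong₂ _+_ ones≡u zeros≡v) u+v≡out) , λ b b∈Full b≈a →
    let lo , hi = agreeing-wt-bounds I a b b≈a
        wb≡e = isolated b∈Full (subst (_≤ wt b) ones≡u lo) (subst (λ z → wt b + z ≤ p) zeros≡v hi)
    in agreeing-extremal⇒≡ I a b b≈a (trans wb≡e (sym wa≡e)) (Sum.map at-lower at-upper endpoint)
  where
  open Window W
  pattern′ = pattern-with-counts a u v (subst (u ≤_) (sym wa≡e) u≤e)
               (subst (λ z → v + z ≤ p) (sym wa≡e) (≤-trans (≤-reflexive (+-comm v e)) e+v≤p))
  I = proj₁ pattern′
  ones≡u = proj₁ (proj₂ pattern′)
  zeros≡v = proj₂ (proj₂ pattern′)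
  at-lower : e ≡ u → wt a ≡ onesOn I a
  at-lower e≡u = trans wa≡e (trans e≡u (sym ones≡u))
  at-upper : e + v ≡ p → wt a + zerosOn I a ≡ p
  at-upper e+v≡p = trans (cong₂ _+_ wa≡e zeros≡v) e+v≡p

-- Available w means that the words of weight w are known to lie in the set
-- separated by I.
out-≤-separator : ∀ {p} (R : BSet p) (Available : ℕ → Set) (I a : Vec Bool p) →
                  (∀ b → restrict I b ≡ restrict I a → Available (wt b) → b ≡ a) → Available (wt a) →
                  (∀ {w} → HasWeight R w → Available w) → out p R ≤ wt I
out-≤-separator {p} R Available I a unique a-available R-available =
  ≤-trans (out-≤-isolated p R (onesOn I a) (zerosOn I a) (wt a) endpoint isolated)
          (≤-reflexive (sym (wt≡onesOn+zerosOn I a)))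
  where
  lo = proj₁ (agreeing-wt-bounds I a a refl)
  hi = proj₂ (agreeing-wt-bounds I a a refl)
  endpoint : (wt a ≡ onesOn I a) ⊎ (wt a + zerosOn I a ≡ p)
  endpoint with onesOn I a <? wt a | (wt a + zerosOn I a) <? p
  ... | yes above-lo | yes below-hi =
    let b , b≈a , wb , b≢a = another-agreeing-word I a above-lo below-hi
    in ⊥-elim (b≢a (unique b b≈a (subst Available (sym wb) a-available)))
  ... | no ¬above-lo | _            = inj₁ (≤-antisym (≮⇒≥ ¬above-lo) lo)
  ... | yes _        | no ¬below-hi = inj₂ (≤-antisym hi (≮⇒≥ ¬below-hi))
  isolated : ∀ {w} → HasWeight R w → onesOn I a ≤ w → w + zerosOn I a ≤ p → w ≡ wt a
  isolated {w} h lo' hi' =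
    let b , b≈a , wb = agreeing-word-of-wt I a w lo' hi'
    in trans (sym wb) (cong wt (unique b b≈a (subst Available (sym wb) (R-available h))))

Symmetric : ∀ {p} → BSet p → Set
Symmetric R = ∀ y y' → R y ≡ true → wt y' ≡ wt y → R y' ≡ true

indexComplexity≡out : ∀ p (R : BSet p) → (∃ λ y → R y ≡ true) → Symmetric R → indexComplexity p R ≡ out p R
indexComplexity≡out p R nonempty symmetric = ≤-antisym upper lower
  where
  W = window p R R nonempty refl
  open Window W
  upper : indexComplexity p R ≤ out p R
  upper with e∈R
  ... | y , Ry , wy≡e with window-separator W y wy≡e
  ...   | I , wI , unique =
    ≤-trans (indexComplexity-≤ R I y (Ry , λ b Rb b≈y → unique b (b , Rb , refl) b≈y)) (≤-reflexive wI)
  lower : out p R ≤ indexComplexity p R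
  lower = ≤-indexComplexity R (out p R) (out-≤ p R) λ I a (Ra , unique) →
    out-≤-separator R (HasWeight R) I a (λ b b≈a (y , Ry , wy) → unique b (symmetric y b Ry (sym wy)) b≈a) (a , Ra , refl) id

-- Sums and the orders ≤_j

sumFin-mono : ∀ {k} (f g : Fin k → ℕ) → (∀ i → f i ≤ g i) → sumFin f ≤ sumFin g
sumFin-mono {zero}  f g f≤g = z≤n
sumFin-mono {suc k} f g f≤g = +-mono-≤ (f≤g zero) (sumFin-mono (f ∘ suc) (g ∘ suc) (f≤g ∘ suc))

sumFin-cong : ∀ {k} (f g : Fin k → ℕ) → (∀ i → f i ≡ g i) → sumFin f ≡ sumFin g
sumFin-cong {zero}  f g f≡g = refl
sumFin-cong {suc k} f g f≡g = cong₂ _+_ (f≡g zero) (sumFin-cong (f ∘ suc) (g ∘ suc) (f≡g ∘ suc))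

pointwise≤∧sumFin≥⇒≡ : ∀ {k} (f g : Fin k → ℕ) → (∀ i → f i ≤ g i) → sumFin g ≤ sumFin f → ∀ i → f i ≡ g i
pointwise≤∧sumFin≥⇒≡ {suc k} f g f≤g Σg≤Σf i with m≤n⇒m<n∨m≡n (f≤g zero)
... | inj₁ f0<g0 = ⊥-elim (<-irrefl refl (≤-trans (+-mono-<-≤ f0<g0 (sumFin-mono (f ∘ suc) (g ∘ suc) (f≤g ∘ suc))) Σg≤Σf))
... | inj₂ f0≡g0 with i
...   | zero  = f0≡g0
...   | suc i = pointwise≤∧sumFin≥⇒≡ (f ∘ suc) (g ∘ suc) (f≤g ∘ suc)
                  (+-cancelˡ-≤ (f zero) _ _ (subst (λ x → x + sumFin (g ∘ suc) ≤ _) (sym f0≡g0) Σg≤Σf)) i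

sumFin-lookup : ∀ {k} (ns : Vec ℕ k) → sumFin (lookup ns) ≡ total ns
sumFin-lookup []       = refl
sumFin-lookup (n ∷ ns) = cong (n +_) (sumFin-lookup ns)

ltDir : Bool → ℕ → ℕ → Set
ltDir false u v = u < v
ltDir true  u v = v < u

ltDir⇒leqDir : ∀ d {u v} → ltDir d u v → leqDir d u v
ltDir⇒leqDir false = <⇒≤
ltDir⇒leqDir true  = <⇒≤

ltDir⇒≢ : ∀ d {u v} → ltDir d u v → u ≢ v
ltDir⇒≢ false u<v u≡v = <-irrefl u≡v u<v
ltDir⇒≢ true  v<u u≡v = <-irrefl (sym u≡v) v<u

leqDir-refl : ∀ d {u} → leqDir d u u
leqDir-refl false = ≤-refl
leqDir-refl true  = ≤-refl

leqDir-antisym : ∀ d {u v} → leqDir d u v → leqDir d v u → u ≡ v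
leqDir-antisym false u≤v v≤u = ≤-antisym u≤v v≤u
leqDir-antisym true  v≤u u≤v = ≤-antisym u≤v v≤u

rank : Bool → ℕ → ℕ → ℕ
rank false n w = w
rank true  n w = n ∸ w

rank-mono : ∀ d n {u v} → leqDir d u v → rank d n u ≤ rank d n v
rank-mono false n u≤v = u≤v
rank-mono true  n v≤u = ∸-monoʳ-≤ n v≤u

rank-reflects : ∀ d n {u v} → v ≤ n → rank d n u ≤ rank d n v → leqDir d u v
rank-reflects false n _   u≤v = u≤v
rank-reflects true  n v≤n le  = ∸-cancelʳ-≤ v≤n le

module _ {R : ℕ → ℕ → Set} where

  AllPairs-lookup : ∀ xs → AllPairs R xs → ∀ i j → toℕ i < toℕ j → R (L.lookup xs i) (L.lookup xs j)
  AllPairs-lookup (x ∷ xs) (x<xs ∷ _)  zero    (suc j) _         = All.lookup x<xs (∈-lookup j)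
  AllPairs-lookup (x ∷ xs) (_ ∷ sorted) (suc i) (suc j) (s≤s i<j) = AllPairs-lookup xs sorted i j i<j

  AllPairs-reverseAcc : ∀ acc xs → AllPairs (flip R) acc → AllPairs R xs →
                        (∀ {a y} → a ∈ acc → y ∈ xs → R a y) → AllPairs (flip R) (L.reverseAcc acc xs)
  AllPairs-reverseAcc acc []       sortedAcc _               _        = sortedAcc
  AllPairs-reverseAcc acc (x ∷ xs) sortedAcc (x<xs ∷ sorted) acc<xs =
    AllPairs-reverseAcc (x ∷ acc) xs (All.tabulate (λ a∈ → acc<xs a∈ (here refl)) ∷ sortedAcc) sorted acc<xs′
    where
    acc<xs′ : ∀ {a y} → a ∈ x ∷ acc → y ∈ xs → R a y
    acc<xs′ (here refl) y∈ = All.lookup x<xs y∈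
    acc<xs′ (there a∈)  y∈ = acc<xs a∈ (there y∈)

module _ (d : Bool) (ws : List ℕ) (sorted : AllPairs (ltDir d) ws) where

  sorted-lookup-mono : ∀ i j → toℕ i ≤ toℕ j → leqDir d (L.lookup ws i) (L.lookup ws j)
  sorted-lookup-mono i j i≤j with m≤n⇒m<n∨m≡n i≤j
  ... | inj₁ i<j = ltDir⇒leqDir d (AllPairs-lookup ws sorted i j i<j)
  ... | inj₂ i≡j rewrite toℕ-injective i≡j = leqDir-refl d

  sorted-lookup-injective : ∀ i j → L.lookup ws i ≡ L.lookup ws j → i ≡ j
  sorted-lookup-injective i j eq with <-cmp (toℕ i) (toℕ j)
  ... | tri< i<j _ _ = ⊥-elim (ltDir⇒≢ d (AllPairs-lookup ws sorted i j i<j) eq)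
  ... | tri≈ _ i≡j _ = toℕ-injective i≡j
  ... | tri> _ _ j<i = ⊥-elim (ltDir⇒≢ d (AllPairs-lookup ws sorted j i j<i) (sym eq))

weights-increasing : ∀ p (R : BSet p) → AllPairs _<_ (weights p R)
weights-increasing p R =
  AllPairs.filter⁺ (T? ∘ λ w → any (λ x → R x ∧ (wt x ≡ᵇ w)) (allVecs p)) (AllPairs.applyUpTo⁺₁ id (suc p) (λ i<j _ → i<j))

module _ {k} (ns : Vec ℕ k) (S : BSet (total ns)) (d : Fin k → Bool) (j : Fin k) where

  orderedW-sorted : AllPairs (ltDir (d j)) (orderedW ns S d j)
  orderedW-sorted with d j
  ... | false = weights-increasing _ (proj ns S j)
  ... | true  = AllPairs-reverseAcc [] (weights _ (proj ns S j)) [] (weights-increasing _ (proj ns S j)) (λ ())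

  ∈orderedW⇒∈weights : ∀ {w} → w ∈ orderedW ns S d j → w ∈ weights _ (proj ns S j)
  ∈orderedW⇒∈weights w∈ with d j
  ... | false = w∈
  ... | true  = reverse⁻ w∈

  ∈weights⇒∈orderedW : ∀ {w} → w ∈ weights _ (proj ns S j) → w ∈ orderedW ns S d j
  ∈weights⇒∈orderedW w∈ with d j
  ... | false = w∈
  ... | true  = reverse⁺ w∈

∈-take⇒lookup : ∀ (ws : List ℕ) u (z : Fin (L.length ws)) → any (λ w → u ≡ᵇ w) (L.take (suc (toℕ z)) ws) ≡ true →
                ∃ λ i → (toℕ i ≤ toℕ z) × (L.lookup ws i ≡ u)
∈-take⇒lookup (w ∷ ws) u z e with ∨-true⁻ {u ≡ᵇ w} e
... | inj₁ u≡w = zero , z≤n , sym (≡ᵇ-true⇒≡ u≡w)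
∈-take⇒lookup (w ∷ ws) u (suc z) e | inj₂ u∈ws =
  let i , i≤z , wsi≡u = ∈-take⇒lookup ws u z u∈ws in suc i , s≤s i≤z , wsi≡u

lookup⇒∈-take : ∀ (ws : List ℕ) u (z : Fin (L.length ws)) → L.lookup ws z ≡ u →
                any (λ w → u ≡ᵇ w) (L.take (suc (toℕ z)) ws) ≡ true
lookup⇒∈-take (w ∷ ws) u zero    refl = ∨-true⁺ˡ (≡ᵇ-refl w)
lookup⇒∈-take (w ∷ ws) u (suc z) e    = ∨-true⁺ʳ {u ≡ᵇ w} (lookup⇒∈-take ws u z e)

-- Permutations of words

Permuted : ∀ {p} → Vec Bool p → Vec Bool p → Set
Permuted {p} x y = Σ (Permutation′ p) λ σ → y ≡ permute σ x

permuted-refl : ∀ {p} (x : Vec Bool p) → Permuted x x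
permuted-refl x = Perm.id , sym (Vecₚ.tabulate∘lookup x)

permuted-trans : ∀ {p} (x y z : Vec Bool p) → Permuted x y → Permuted y z → Permuted x z
permuted-trans x _ _ (σ , refl) (τ , refl) =
  τ ∘ₚ σ , Vecₚ.tabulate-cong (λ i → Vecₚ.lookup∘tabulate (λ j → lookup x (σ ⟨$⟩ʳ j)) (τ ⟨$⟩ʳ i))

permuted-sym : ∀ {p} (x y : Vec Bool p) → Permuted x y → Permuted y x
permuted-sym x _ (σ , refl) = Perm.flip σ , sym (trans
  (Vecₚ.tabulate-cong (λ i → trans (Vecₚ.lookup∘tabulate (λ j → lookup x (σ ⟨$⟩ʳ j)) (σ ⟨$⟩ˡ i)) (cong (lookup x) (inverseʳ σ))))
  (Vecₚ.tabulate∘lookup x))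

permuted-∷ : ∀ {p} b (x y : Vec Bool p) → Permuted x y → Permuted (b ∷ x) (b ∷ y)
permuted-∷ b _ _ (σ , refl) = lift₀ σ , refl

permuted-swap : ∀ {p} a b (x : Vec Bool p) → Permuted (a ∷ b ∷ x) (b ∷ a ∷ x)
permuted-swap a b x = transpose zero (suc zero) , cong (λ t → b ∷ a ∷ t) (sym (Vecₚ.tabulate∘lookup x))

permuted-true-first : ∀ {p} (y : Vec Bool (suc p)) m → wt y ≡ suc m →
                      ∃ λ (y′ : Vec Bool p) → (wt y′ ≡ m) × Permuted y (true ∷ y′)
permuted-true-first (true ∷ y) m e = y , suc-injective e , permuted-refl _
permuted-true-first (false ∷ b ∷ y) m e =
  let y′ , wy′ , y~ = permuted-true-first (b ∷ y) m e
  in false ∷ y′ , wy′ , permuted-trans (false ∷ b ∷ y) (false ∷ true ∷ y′) (true ∷ false ∷ y′) (permuted-∷ false (b ∷ y) (true ∷ y′) y~) (permuted-swap false true y′)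

equal-wt⇒permuted : ∀ {p} (x y : Vec Bool p) → wt x ≡ wt y → Permuted x y
true-false⇒permuted : ∀ {p} (x y : Vec Bool p) → suc (wt x) ≡ wt y → Permuted (true ∷ x) (false ∷ y)

equal-wt⇒permuted []          []          _ = permuted-refl []
equal-wt⇒permuted (true ∷ x)  (true ∷ y)  e = permuted-∷ true x y (equal-wt⇒permuted x y (suc-injective e))
equal-wt⇒permuted (false ∷ x) (false ∷ y) e = permuted-∷ false x y (equal-wt⇒permuted x y e)
equal-wt⇒permuted (true ∷ x)  (false ∷ y) e = true-false⇒permuted x y e
equal-wt⇒permuted (false ∷ x) (true ∷ y)  e = permuted-sym (true ∷ y) (false ∷ x) (true-false⇒permuted y x (sym e))

true-false⇒permuted {zero} [] [] ()
true-false⇒permuted {suc p} x y e =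
  let y′ , wy′ , y~ = permuted-true-first y (wt x) (sym e)
  in permuted-trans (true ∷ x) (true ∷ false ∷ y′) (false ∷ y)
       (permuted-∷ true x (false ∷ y′) (equal-wt⇒permuted x (false ∷ y′) (sym wy′)))
       (permuted-trans (true ∷ false ∷ y′) (false ∷ true ∷ y′) (false ∷ y) (permuted-swap true false y′)
         (permuted-∷ false (true ∷ y′) y (permuted-sym y (true ∷ y′) y~)))

-- Blocks

Blocks : ∀ {k} → Vec ℕ k → Set
Blocks {k} ns = (j : Fin k) → Vec Bool (lookup ns j)

assemble : ∀ {k} (ns : Vec ℕ k) → Blocks ns → Vec Bool (total ns)
assemble []       f = []
assemble (n ∷ ns) f = f zero V.++ assemble ns (f ∘ suc)

take-++ : ∀ {m n} (u : Vec Bool m) (v : Vec Bool n) → V.take m (u V.++ v) ≡ u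
take-++ {m} u v = Vecₚ.++-injectiveˡ (V.take m (u V.++ v)) u (Vecₚ.take++drop≡id m (u V.++ v))

drop-++ : ∀ {m n} (u : Vec Bool m) (v : Vec Bool n) → V.drop m (u V.++ v) ≡ v
drop-++ {m} u v = Vecₚ.++-injectiveʳ (V.take m (u V.++ v)) u (Vecₚ.take++drop≡id m (u V.++ v))

block-assemble : ∀ {k} (ns : Vec ℕ k) (f : Blocks ns) j → block ns (assemble ns f) j ≡ f j
block-assemble (n ∷ ns) f zero    = take-++ (f zero) _
block-assemble (n ∷ ns) f (suc j) rewrite drop-++ (f zero) (assemble ns (f ∘ suc)) = block-assemble ns (f ∘ suc) j

assemble-cong : ∀ {k} (ns : Vec ℕ k) (f g : Blocks ns) → (∀ j → f j ≡ g j) → assemble ns f ≡ assemble ns g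
assemble-cong []       f g f≡g = refl
assemble-cong (n ∷ ns) f g f≡g = cong₂ V._++_ (f≡g zero) (assemble-cong ns (f ∘ suc) (g ∘ suc) (f≡g ∘ suc))

assemble-block : ∀ {k} (ns : Vec ℕ k) (x : Vec Bool (total ns)) → assemble ns (block ns x) ≡ x
assemble-block []       []    = refl
assemble-block (n ∷ ns) x = trans (cong (V.take n x V.++_) (assemble-block ns (V.drop n x))) (Vecₚ.take++drop≡id n x)

block-injective : ∀ {k} (ns : Vec ℕ k) (x y : Vec Bool (total ns)) → (∀ j → block ns x j ≡ block ns y j) → x ≡ y
block-injective ns x y same =
  trans (sym (assemble-block ns x)) (trans (assemble-cong ns _ _ same) (assemble-block ns y))

wt-++ : ∀ {m n} (u : Vec Bool m) (v : Vec Bool n) → wt (u V.++ v) ≡ wt u + wt v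
wt-++ []          v = refl
wt-++ (true ∷ u)  v = cong suc (wt-++ u v)
wt-++ (false ∷ u) v = wt-++ u v

wt-assemble : ∀ {k} (ns : Vec ℕ k) (f : Blocks ns) → wt (assemble ns f) ≡ sumFin (λ j → wt (f j))
wt-assemble []       f = refl
wt-assemble (n ∷ ns) f = trans (wt-++ (f zero) _) (cong (wt (f zero) +_) (wt-assemble ns (f ∘ suc)))

restrict-++ : ∀ {m n} (I u : Vec Bool m) (J v : Vec Bool n) → restrict (I V.++ J) (u V.++ v) ≡ restrict I u L.++ restrict J v
restrict-++ []          []      J v = refl
restrict-++ (true ∷ I)  (x ∷ u) J v = cong (x ∷_) (restrict-++ I u J v)
restrict-++ (false ∷ I) (x ∷ u) J v = restrict-++ I u J v

++-injective-≡length : ∀ (as bs : List Bool) {cs ds} → L.length as ≡ L.length bs → as L.++ cs ≡ bs L.++ ds →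
                        (as ≡ bs) × (cs ≡ ds)
++-injective-≡length []       []       _  e = refl , e
++-injective-≡length (a ∷ as) (b ∷ bs) ≡l e =
  let as≡bs , cs≡ds = ++-injective-≡length as bs (suc-injective ≡l) (∷-injectiveʳ e)
  in cong₂ _∷_ (∷-injectiveˡ e) as≡bs , cs≡ds

restrict-assemble⁺ : ∀ {k} (ns : Vec ℕ k) (I a b : Blocks ns) → (∀ j → restrict (I j) (b j) ≡ restrict (I j) (a j)) →
                     restrict (assemble ns I) (assemble ns b) ≡ restrict (assemble ns I) (assemble ns a)
restrict-assemble⁺ []       I a b agree = refl
restrict-assemble⁺ (n ∷ ns) I a b agree
  rewrite restrict-++ (I zero) (b zero) (assemble ns (I ∘ suc)) (assemble ns (b ∘ suc))
        | restrict-++ (I zero) (a zero) (assemble ns (I ∘ suc)) (assemble ns (a ∘ suc)) =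
  cong₂ L._++_ (agree zero) (restrict-assemble⁺ ns (I ∘ suc) (a ∘ suc) (b ∘ suc) (agree ∘ suc))

restrict-assemble⁻ : ∀ {k} (ns : Vec ℕ k) (I a b : Blocks ns) →
                     restrict (assemble ns I) (assemble ns b) ≡ restrict (assemble ns I) (assemble ns a) →
                     ∀ j → restrict (I j) (b j) ≡ restrict (I j) (a j)
restrict-assemble⁻ (n ∷ ns) I a b agree j
  rewrite restrict-++ (I zero) (b zero) (assemble ns (I ∘ suc)) (assemble ns (b ∘ suc))
        | restrict-++ (I zero) (a zero) (assemble ns (I ∘ suc)) (assemble ns (a ∘ suc))
  with ++-injective-≡length (restrict (I zero) (b zero)) (restrict (I zero) (a zero))
         (trans (length-restrict (I zero) (b zero)) (sym (length-restrict (I zero) (a zero)))) agree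
... | head , _    with j
...   | zero  = head
restrict-assemble⁻ (n ∷ ns) I a b agree j | _ , rest | suc j′ = restrict-assemble⁻ ns (I ∘ suc) (a ∘ suc) (b ∘ suc) rest j′

updateBlock : ∀ {k} (ns : Vec ℕ k) → Blocks ns → (j : Fin k) → Vec Bool (lookup ns j) → Blocks ns
updateBlock (n ∷ ns) f zero    y zero    = y
updateBlock (n ∷ ns) f zero    y (suc i) = f (suc i)
updateBlock (n ∷ ns) f (suc j) y zero    = f zero
updateBlock (n ∷ ns) f (suc j) y (suc i) = updateBlock ns (f ∘ suc) j y i

updateBlock-same : ∀ {k} (ns : Vec ℕ k) f j y → updateBlock ns f j y j ≡ y
updateBlock-same (n ∷ ns) f zero    y = refl
updateBlock-same (n ∷ ns) f (suc j) y = updateBlock-same ns (f ∘ suc) j y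

updateBlock-preserves : ∀ {k} (ns : Vec ℕ k) (Q : (i : Fin k) → Vec Bool (lookup ns i) → Set) f j y →
                        (∀ i → Q i (f i)) → Q j y → ∀ i → Q i (updateBlock ns f j y i)
updateBlock-preserves (n ∷ ns) Q f zero    y Qf Qy zero    = Qy
updateBlock-preserves (n ∷ ns) Q f zero    y Qf Qy (suc i) = Qf (suc i)
updateBlock-preserves (n ∷ ns) Q f (suc j) y Qf Qy zero    = Qf zero
updateBlock-preserves (n ∷ ns) Q f (suc j) y Qf Qy (suc i) = updateBlock-preserves ns (Q ∘ suc) (f ∘ suc) j y (Qf ∘ suc) Qy i

KWiseSymmetric⇒wt-closed : ∀ {k} (ns : Vec ℕ k) (S : BSet (total ns)) → KWiseSymmetric ns S →
                           ∀ x (f : Blocks ns) → S x ≡ true → (∀ j → wt (f j) ≡ wt (block ns x j)) → S (assemble ns f) ≡ true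
KWiseSymmetric⇒wt-closed ns S kwise x f Sx same-wt =
  kwise (λ j → proj₁ (permutation j)) x (assemble ns f) (λ j → trans (block-assemble ns f j) (proj₂ (permutation j))) Sx
  where
  permutation : ∀ j → Permuted (block ns x j) (f j)
  permutation j = equal-wt⇒permuted (block ns x j) (f j) (sym (same-wt j))

-- Projections and innext(S)

module _ {k} (ns : Vec ℕ k) (S : BSet (total ns)) where

  proj⇒block : ∀ j y → proj ns S j y ≡ true → ∃ λ x → (S x ≡ true) × (block ns x j ≡ y)
  proj⇒block j y e =
    let x , _ , Sx∧eq = any-true⁻ (λ x → S x ∧ eqVec (block ns x j) y) (allVecs (total ns)) e
        Sx , eq = ∧-true⁻ Sx∧eq
    in x , Sx , eqVec-true⇒≡ _ _ eq

  block∈proj : ∀ j x → S x ≡ true → proj ns S j (block ns x j) ≡ true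
  block∈proj j x Sx = any-true⁺ (λ x′ → S x′ ∧ eqVec (block ns x′ j) (block ns x j)) (∈-allVecs x)
                                (∧-true⁺ Sx (eqVec-refl (block ns x j)))

  proj-symmetric : KWiseSymmetric ns S → ∀ j → Symmetric (proj ns S j)
  proj-symmetric kwise j y y′ Sjy wy′≡wy with proj⇒block j y Sjy
  ... | x , Sx , refl = subst (λ b → proj ns S j b ≡ true) (trans (block-assemble ns f j) (updateBlock-same ns (block ns x) j y′))
                              (block∈proj j (assemble ns f) Sf)
    where
    f = updateBlock ns (block ns x) j y′
    Sf = KWiseSymmetric⇒wt-closed ns S kwise x f Sx
           (updateBlock-preserves ns (λ i v → wt v ≡ wt (block ns x i)) (block ns x) j y′ (λ _ → refl) wy′≡wy)

  projections-nonempty : (∃ λ x → S x ≡ true) → ∀ j → ∃ λ y → proj ns S j y ≡ true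
  projections-nonempty (x , Sx) j = block ns x j , block∈proj j x Sx

  assemble-separates : ∀ x (I : Blocks ns) → S x ≡ true →
                       (∀ j b → proj ns S j b ≡ true → restrict (I j) b ≡ restrict (I j) (block ns x j) → b ≡ block ns x j) →
                       Separates S (assemble ns I) x
  assemble-separates x I Sx separated = Sx , λ b Sb b≈x →
    let b≈x′ = subst₂ (λ u v → restrict (assemble ns I) u ≡ restrict (assemble ns I) v)
                      (sym (assemble-block ns b)) (sym (assemble-block ns x)) b≈x
    in block-injective ns b x λ j →
         separated j (block ns b j) (block∈proj j b Sb) (restrict-assemble⁻ ns I (block ns x) (block ns b) b≈x′ j)

module _ {k} (ns : Vec ℕ k) (S : BSet (total ns)) (d : Fin k → Bool) where

  top : Idx ns S d → (j : Fin k) → ℕ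
  top z j = L.lookup (orderedW ns S d j) (z j)

  ∈orderedW⇒HasWeight : ∀ j {w} → w ∈ orderedW ns S d j → HasWeight (proj ns S j) w
  ∈orderedW⇒HasWeight j w∈ = ∈weights⇒HasWeight _ (proj ns S j) (∈orderedW⇒∈weights ns S d j w∈)

  HasWeight⇒∈orderedW : ∀ j {w} → HasWeight (proj ns S j) w → w ∈ orderedW ns S d j
  HasWeight⇒∈orderedW j h = ∈weights⇒∈orderedW ns S d j (HasWeight⇒∈weights _ (proj ns S j) h)

  blockRank : (j : Fin k) → Vec Bool (total ns) → ℕ
  blockRank j x = rank (d j) (lookup ns j) (wt (block ns x j))

  score : Vec Bool (total ns) → ℕ
  score x = sumFin (λ j → blockRank j x)

  Above : Vec Bool (total ns) → Vec Bool (total ns) → Set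
  Above x₀ x = (S x ≡ true) × (∀ j → blockRank j x₀ ≤ blockRank j x)

  Above? : ∀ x₀ x → Dec (Above x₀ x)
  Above? x₀ x = (S x Bool.≟ true) ×-dec all? (λ j → blockRank j x₀ ≤? blockRank j x)

  maximal-above : ∀ x₀ → S x₀ ≡ true → ∃ λ x → Above x₀ x × (∀ x′ → Above x₀ x′ → score x′ ≤ score x)
  maximal-above x₀ Sx₀ =
    argmax score x₀ candidates ,
    argmax-all score (Sx₀ , λ _ → ≤-refl) (all-filter (Above? x₀) (allVecs _)) ,
    λ x′ above → All.lookup (f[xs]≤f[argmax] x₀ candidates) (∈-filter⁺ (Above? x₀) (∈-allVecs x′) above)
    where
    candidates = L.filter (Above? x₀) (allVecs (total ns))

  -- The index tuple of a word of maximal total rank above x₀ is maximal in 𝒩(S).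
  innext-above : ∀ x₀ → S x₀ ≡ true →
                 Σ (Idx ns S d) λ z → InInnext ns S d z × (∀ j → leqDir (d j) (wt (block ns x₀ j)) (top z j))
  innext-above x₀ Sx₀ = z , (z∈N , z-maximal) , λ j → subst (leqDir (d j) _) (z-lookup j) (x₀≤m j)
    where
    maximum = maximal-above x₀ Sx₀
    m = proj₁ maximum
    Sm = proj₁ (proj₁ (proj₂ maximum))
    x₀≤m : ∀ j → leqDir (d j) (wt (block ns x₀ j)) (wt (block ns m j))
    x₀≤m j = rank-reflects (d j) (lookup ns j) (wt≤length (block ns m j)) (proj₂ (proj₁ (proj₂ maximum)) j)
    m-max = proj₂ (proj₂ maximum)
    m-weight∈ : ∀ j → wt (block ns m j) ∈ orderedW ns S d j
    m-weight∈ j = HasWeight⇒∈orderedW j (block ns m j , block∈proj ns S j m Sm , refl)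
    z : Idx ns S d
    z j = Any.index (m-weight∈ j)
    z-lookup : ∀ j → wt (block ns m j) ≡ top z j
    z-lookup j = lookup-index (m-weight∈ j)
    z∈N : InN ns S d z
    z∈N = m , Sm , z-lookup
    z-maximal : ∀ z′ → InN ns S d z′ → (∀ j → z j Fin.≤ z′ j) → ∀ j → z′ j ≡ z j
    z-maximal z′ (x′ , Sx′ , x′-weights) z≤z′ j =
      sorted-lookup-injective (d j) _ (orderedW-sorted ns S d j) (z′ j) (z j)
        (trans (sym (x′-weights j)) (trans (sym (leqDir-antisym (d j) (m≤x′ j) x′≤m)) (z-lookup j)))
      where
      m≤x′ : ∀ i → leqDir (d i) (wt (block ns m i)) (wt (block ns x′ i))
      m≤x′ i = subst₂ (leqDir (d i)) (sym (z-lookup i)) (sym (x′-weights i))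
                      (sorted-lookup-mono (d i) _ (orderedW-sorted ns S d i) (z i) (z′ i) (z≤z′ i))
      ranks≡ = pointwise≤∧sumFin≥⇒≡ (λ i → blockRank i m) (λ i → blockRank i x′)
                 (λ i → rank-mono (d i) (lookup ns i) (m≤x′ i))
                 (m-max x′ (Sx′ , λ i → ≤-trans (proj₂ (proj₁ (proj₂ maximum)) i) (rank-mono (d i) (lookup ns i) (m≤x′ i))))
      x′≤m = rank-reflects (d j) (lookup ns j) (wt≤length (block ns m j)) (≤-reflexive (sym (ranks≡ j)))

  truncation⇒below-top : ∀ (z : Idx ns S d) j {w} → HasWeight (truncSym ns S d j (z j)) w →
                         HasWeight (proj ns S j) w × leqDir (d j) w (top z j)
  truncation⇒below-top z j (y , Ty , refl) =
    let i , i≤z , wi≡ = ∈-take⇒lookup (orderedW ns S d j) (wt y) (z j) Ty in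
    subst (HasWeight (proj ns S j)) wi≡ (∈orderedW⇒HasWeight j (∈-lookup i)) ,
    subst (λ w → leqDir (d j) w (top z j)) wi≡ (sorted-lookup-mono (d j) _ (orderedW-sorted ns S d j) i (z j) i≤z)

  truncation-nonempty : ∀ (z : Idx ns S d) j → ∃ λ y → truncSym ns S d j (z j) y ≡ true
  truncation-nonempty z j =
    let y , _ , wy≡ = ∈orderedW⇒HasWeight j (∈-lookup {xs = orderedW ns S d j} (z j))
    in y , lookup⇒∈-take (orderedW ns S d j) (wt y) (z j) (sym wy≡)

-- The two bounds on r_N(S)

module _ {k} (ns : Vec ℕ k) (S : BSet (total ns)) (kwise : KWiseSymmetric ns S) (d : Fin k → Bool)
         (downClosed : DownClosed ns S d) (outerIntact : OuterIntact ns S d) where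

  Σout : ℕ
  Σout = sumFin (λ j → out (lookup ns j) (proj ns S j))

  indexComplexity-≤-Σout : ∀ x₀ → S x₀ ≡ true → indexComplexity (total ns) S ≤ Σout
  indexComplexity-≤-Σout x₀ Sx₀ =
    ≤-trans (indexComplexity-≤ S (assemble ns I) x (assemble-separates ns S x I Sx separated)) (≤-reflexive wt-I)
    where
    innext = innext-above ns S d x₀ Sx₀
    z = proj₁ innext
    z∈innext = proj₁ (proj₂ innext)
    W : ∀ j → Window (lookup ns j) (truncSym ns S d j (z j)) (proj ns S j)
    W j = window (lookup ns j) _ (proj ns S j) (truncation-nonempty ns S d z j) (outerIntact z z∈innext j)
    e-below = λ j → truncation⇒below-top ns S d z j (Window.e∈R (W j))
    e∈W = downClosed (λ j → Window.e (W j)) (top ns S d z) (proj₁ z∈innext) (proj₁ ∘ e-below) (proj₂ ∘ e-below)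
    x = proj₁ e∈W
    Sx = proj₁ (proj₂ e∈W)
    separator = λ j → window-separator (W j) (block ns x j) (proj₂ (proj₂ e∈W) j)
    I : Blocks ns
    I j = proj₁ (separator j)
    separated = λ j b Sjb → proj₂ (proj₂ (separator j)) b (b , Sjb , refl)
    wt-I : wt (assemble ns I) ≡ Σout
    wt-I = trans (wt-assemble ns I) (sumFin-cong _ _ (proj₁ ∘ proj₂ ∘ separator))

  out-proj-≤-wt-block : ∀ I a → Separates S I a → ∀ j → out (lookup ns j) (proj ns S j) ≤ wt (block ns I j)
  out-proj-≤-wt-block I a (Sa , unique) j =
    subst (_≤ wt (block ns I j)) (out-cong (lookup ns j) (outerIntact z z∈innext j))
      (out-≤-separator (truncSym ns S d j (z j)) (Available j) (block ns I j) (block ns a j)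
                       block-separated (a-available j) (truncation⇒below-top ns S d z j))
    where
    innext = innext-above ns S d a Sa
    z = proj₁ innext
    z∈innext = proj₁ (proj₂ innext)
    Available : (i : Fin k) → ℕ → Set
    Available i w = HasWeight (proj ns S i) w × leqDir (d i) w (top ns S d z i)
    a-available : ∀ i → Available i (wt (block ns a i))
    a-available i = (block ns a i , block∈proj ns S i a Sa , refl) , proj₂ (proj₂ innext) i
    block-separated : ∀ b → restrict (block ns I j) b ≡ restrict (block ns I j) (block ns a j) →
                      Available j (wt b) → b ≡ block ns a j
    block-separated b b≈a b-available =
      trans (sym (trans (block-assemble ns f j) (updateBlock-same ns (block ns a) j b))) (cong (λ x → block ns x j) f≡a)
      where
      f = updateBlock ns (block ns a) j b
      f-available = updateBlock-preserves ns (λ i v → Available i (wt v)) (block ns a) j b a-available b-available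
      wf∈W = downClosed (λ i → wt (f i)) (top ns S d z) (proj₁ z∈innext) (proj₁ ∘ f-available) (proj₂ ∘ f-available)
      Sf = KWiseSymmetric⇒wt-closed ns S kwise (proj₁ wf∈W) f (proj₁ (proj₂ wf∈W)) (sym ∘ proj₂ (proj₂ wf∈W))
      f≈a = subst₂ (λ J y → restrict J (assemble ns f) ≡ restrict J y) (assemble-block ns I) (assemble-block ns a)
              (restrict-assemble⁺ ns (block ns I) (block ns a) f
                (updateBlock-preserves ns (λ i v → restrict (block ns I i) v ≡ restrict (block ns I i) (block ns a i))
                                       (block ns a) j b (λ _ → refl) b≈a))
      f≡a = unique (assemble ns f) Sf f≈a

  Σout-≤-indexComplexity : Σout ≤ indexComplexity (total ns) S
  Σout-≤-indexComplexity =
    ≤-indexComplexity S Σout Σout≤N λ I a sep →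
      ≤-trans (sumFin-mono _ _ (out-proj-≤-wt-block I a sep))
              (≤-reflexive (trans (sym (wt-assemble ns (block ns I))) (cong wt (assemble-block ns I))))
    where
    Σout≤N = ≤-trans (sumFin-mono _ _ (λ j → out-≤ (lookup ns j) (proj ns S j))) (≤-reflexive (sumFin-lookup ns))

proposition1p41 :
    ∀ {k} (ns : Vec ℕ k) (S : BSet (total ns)) →
    KWiseSymmetric ns S →
    (∃ λ x → S x ≡ true) →
    (Σ (Fin k → Bool) λ d → DownClosed ns S d × OuterIntact ns S d) →
    (indexComplexity (total ns) S ≡ sumFin (λ j → indexComplexity (lookup ns j) (proj ns S j)))
    × (sumFin (λ j → indexComplexity (lookup ns j) (proj ns S j))
       ≡ sumFin (λ j → out (lookup ns j) (proj ns S j)))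
proposition1p41 ns S kwise (x₀ , Sx₀) (d , downClosed , outerIntact) = trans r≡Σout (sym Σr≡Σout) , Σr≡Σout
  where
  r≡Σout = ≤-antisym (indexComplexity-≤-Σout ns S kwise d downClosed outerIntact x₀ Sx₀)
                     (Σout-≤-indexComplexity ns S kwise d downClosed outerIntact)
  Σr≡Σout = sumFin-cong _ _ λ j →
    indexComplexity≡out _ (proj ns S j) (projections-nonempty ns S (x₀ , Sx₀) j) (proj-symmetric ns S kwise j)
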